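{- Let $r_k,s_k,t_k$ be elements of a commutative ring with associated Catalan-Stieltjes matrix $(c_{i,j})$. Fix $k\ge0$ and $n\ge0$, and equip $D^{C_{2n+k}}$ with weights as described (each block Type chosen independently among the applicable ones). Let $D^{H_n}$ be the subgraph of $D^{C_{2n+k}}$ formed by the arcs of all directed paths from $P_k^{(k)}$ to $P_{2n+k}^{(2n+k)}$, with the restricted weights. Then for all $0\le i,j\le n$, $$c_{i+j,0}=GF_{D^{H_n}}\big(P_{n+k-i}^{(n+k-i)},P_{n+k+j}^{(n+k+j)}\big).$$
   Context: The Catalan-Stieltjes matrix $(c_{i,j})_{i,j\ge0}$ is lower triangular with $c_{0,0}=1$, $c_{i,0}=s_0c_{i-1,0}+t_1c_{i-1,1}$ and $c_{i,j}=r_{j-1}c_{i-1,j-1}+s_jc_{i-1,j}+t_{j+1}c_{i-1,j+1}$ for $i,j\ge1$; conventions $r_{ -1}=t_0=0$. For $m\ge0$ the block $D^{L_m}$ has vertices $P_i^{(m)},Q_i^{(m)},P_i^{(m+1)}$ ($0\le i\le m+1$) and arcs $P_k^{(m)}\to Q_k^{(m)}$, $Q_k^{(m)}\to P_k^{(m+1)}$ ($0\le k\le m+1$), and $P_k^{(m)}\to Q_{k+1}^{(m)}$, $Q_k^{(m)}\to P_{k+1}^{(m+1)}$, $P_k^{(m)}\to P_{k+1}^{(m+1)}$ ($0\le k\le m$). For $N\ge1$, $D^{C_N}$ is the union of $D^{L_0},\dots,D^{L_{N-1}}$ (same-named vertices identified) plus connecting arcs $P_i^{(m)}\to P_i^{(m+1)}$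 for $0\le m\le N-1$, $m+2\le i\le N$, of weight $1$. Each block $D^{L_m}$ is weighted by one of the following Types (for $0\le k\le m$ unless stated; unlisted block arcs weight $1$; Type 5 only if there exist ring elements $b_k,c_k$ with $r_k=1,s_k=b_k+c_k,t_{k+1}=b_{k+1}c_k$ for all $k$): Type 1: $P_k^{(m)}\to Q_k^{(m)}$: $r_{m-k}$; $P_k^{(m)}\to Q_{k+1}^{(m)}$: $t_{m-k}$; $P_k^{(m)}\to P_{k+1}^{(m+1)}$: $s_{m-k}-r_{m-k}-t_{m-k}$. Type 2: $Q_k^{(m)}\to P_k^{(m+1)}$: $r_{m-k}$; $Q_k^{(m)}\to P_{k+1}^{(m+1)}$: $t_{m-k+1}$; $P_k^{(m)}\to P_{k+1}^{(m+1)}$: $s_{m-k}-r_{m-k-1}-t_{m-k+1}$; $P_m^{(m)}\to Q_{m+1}^{(m)}$: $0$. Type 3: $Q_k^{(m)}\to P_k^{(m+1)}$: $r_{m-k}$; $P_k^{(m)}\to Q_{k+1}^{(m)}$: $t_{m-k}$; $P_k^{(m)}\to P_{k+1}^{(m+1)}$: $s_{m-k}-r_{m-k-1}t_{m-k}-1$. Type 4: $P_k^{(m)}\to Q_k^{(m)}$: $r_{m-k}$; $Q_k^{(m)}\to P_{k+1}^{(m+1)}$: $t_{m-k+1}$; $P_k^{(m)}\to P_{k+1}^{(m+1)}$: $s_{m-k}-r_{m-k}t_{m-k+1}-1$ ($0\le k\le m-1$); $P_m^{(m)}\to P_{m+1}^{(m+1)}$: $s_0-r_0t_1$; $P_m^{(m)}\to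 Q_{m+1}^{(m)}$: $0$. Type 5: $P_k^{(m)}\to Q_{k+1}^{(m)}$: $b_{m-k}$; $Q_k^{(m)}\to P_{k+1}^{(m+1)}$: $c_{m-k}$; $P_k^{(m)}\to P_{k+1}^{(m+1)}$: $0$. $GF_D(u,v)$ is the sum over directed paths in $D$ from $u$ to $v$ of the product of arc weights, $GF_D(u,u)=1$. -}

module Defs where

open import Algebra.Bundles using (CommutativeRing)
open import Data.Nat using (ℕ; zero; suc; _∸_; _≤?_; _<?_; _≟_)
import Data.Nat as ℕ
open import Data.Bool using (Bool; true; false; if_then_else_; _∧_; not)
open import Data.List using (List; []; _∷_; _++_; map; concatMap; filterᵇ; foldr; null)
open import Data.Product using (_×_; _,_)
open import Relation.Nullary using (does)

data BlockType : Set where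
  type1 type2 type3 type4 type5 : BlockType

-- Vertices: P i m = P_i^{(m)},  Q i m = Q_i^{(m)}  (subscript first, superscript second).
data Vertex : Set where
  P : ℕ → ℕ → Vertex
  Q : ℕ → ℕ → Vertex

_==_ : Vertex → Vertex → Bool
P i m == P i' m' = does (i ≟ i') ∧ does (m ≟ m')
Q i m == Q i' m' = does (i ≟ i') ∧ does (m ≟ m')
_ == _ = false

-- The five kinds of arcs of a block D^{L_m}, named by the source subscript k:
--   PQ  : P_k^{(m)} → Q_k^{(m)}          (0 ≤ k ≤ m+1)
--   QP  : Q_k^{(m)} → P_k^{(m+1)}        (0 ≤ k ≤ m+1)
--   PQ' : P_k^{(m)} → Q_{k+1}^{(m)}      (0 ≤ k ≤ m)
--   QP' : Q_k^{(m)} → P_{k+1}^{(m+1)}    (0 ≤ k ≤ m)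
--   PP' : P_k^{(m)} → P_{k+1}^{(m+1)}    (0 ≤ k ≤ m)
data ArcKind : Set where
  PQ QP PQ' QP' PP' : ArcKind

module _ {a ℓ} (R : CommutativeRing a ℓ) where
  open CommutativeRing R

  private
    _−_ : Carrier → Carrier → Carrier
    x − y = x + (- y)
    infixl 6 _−_

  -- r with the convention r_{-1} = 0 :  rm1 r j = r_{j-1}
  rm1 : (ℕ → Carrier) → ℕ → Carrier
  rm1 r zero    = 0#
  rm1 r (suc j) = r j

  -- t with the convention t_0 = 0 (the value t 0 is never used)
  t0 : (ℕ → Carrier) → ℕ → Carrier
  t0 t zero    = 0#
  t0 t (suc j) = t (suc j)

  catalan : (r s t : ℕ → Carrier) → ℕ → ℕ → Carrier
  catalan r s t zero    zero    = 1#
  catalan r s t zero    (suc j) = 0#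
  catalan r s t (suc i) zero    =
    s 0 * catalan r s t i 0 + t 1 * catalan r s t i 1
  catalan r s t (suc i) (suc j) =
    r j * catalan r s t i j + s (suc j) * catalan r s t i (suc j)
      + t (suc (suc j)) * catalan r s t i (suc (suc j))

  Type5Admissible : (r s t b c : ℕ → Carrier) → Set ℓ
  Type5Admissible r s t b c =
    (k : ℕ) → (r k ≈ 1#) × (s k ≈ b k + c k) × (t (suc k) ≈ b (suc k) * c k)

  -- Weight of the arc of kind κ with source subscript k in block m of the given Type.
  -- (Unlisted arcs get weight 1.)  Here j = m - k.
  blockWeight : (r s t b c : ℕ → Carrier) → BlockType → ArcKind → (m k : ℕ) → Carrier
  blockWeight r s t b c type1 PQ  m k = if does (k ≤? m) then r (m ∸ k) else 1#
  blockWeight r s t b c type1 PQ' m k = t0 t (m ∸ k)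
  blockWeight r s t b c type1 PP' m k = s (m ∸ k) − r (m ∸ k) − t0 t (m ∸ k)
  blockWeight r s t b c type1 _   m k = 1#
  blockWeight r s t b c type2 QP  m k = if does (k ≤? m) then r (m ∸ k) else 1#
  blockWeight r s t b c type2 QP' m k = t (suc (m ∸ k))
  blockWeight r s t b c type2 PP' m k = s (m ∸ k) − rm1 r (m ∸ k) − t (suc (m ∸ k))
  blockWeight r s t b c type2 PQ' m k = if does (k ≟ m) then 0# else 1#
  blockWeight r s t b c type2 _   m k = 1#
  blockWeight r s t b c type3 QP  m k = if does (k ≤? m) then r (m ∸ k) else 1#
  blockWeight r s t b c type3 PQ' m k = t0 t (m ∸ k)
  blockWeight r s t b c type3 PP' m k = s (m ∸ k) − rm1 r (m ∸ k) * t0 t (m ∸ k) − 1#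
  blockWeight r s t b c type3 _   m k = 1#
  blockWeight r s t b c type4 PQ  m k = if does (k ≤? m) then r (m ∸ k) else 1#
  blockWeight r s t b c type4 QP' m k = t (suc (m ∸ k))
  blockWeight r s t b c type4 PP' m k =
    if does (k <? m) then s (m ∸ k) − r (m ∸ k) * t (suc (m ∸ k)) − 1#
                     else s 0 − r 0 * t 1
  blockWeight r s t b c type4 PQ' m k = if does (k ≟ m) then 0# else 1#
  blockWeight r s t b c type4 _   m k = 1#
  blockWeight r s t b c type5 PQ' m k = b (m ∸ k)
  blockWeight r s t b c type5 QP' m k = c (m ∸ k)
  blockWeight r s t b c type5 PP' m k = 0#
  blockWeight r s t b c type5 _   m k = 1#

  Digraph : Set a
  Digraph = Vertex → List (Vertex × Carrier)

  DC : (r s t b c : ℕ → Carrier) → (ℕ → BlockType) → ℕ → Digraph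
  DC r s t b c τ N (P i m) =
    if does (m <? N)
    then ((if does (i ≤? suc m) then (Q i m , w PQ) ∷ [] else [])
          ++ (if does (i ≤? m)
              then (Q (suc i) m , w PQ') ∷ (P (suc i) (suc m) , w PP') ∷ []
              else [])
          ++ (if does (suc (suc m) ≤? i) ∧ does (i ≤? N)
              then (P i (suc m) , 1#) ∷ []
              else []))
    else []
    where w : ArcKind → Carrier
          w κ = blockWeight r s t b c (τ m) κ m i
  DC r s t b c τ N (Q i m) =
    if does (m <? N)
    then ((if does (i ≤? suc m) then (P i (suc m) , w QP) ∷ [] else [])
          ++ (if does (i ≤? m) then (P (suc i) (suc m) , w QP') ∷ [] else []))
    else []
    where w : ArcKind → Carrier
          w κ = blockWeight r s t b c (τ m) κ m i

  -- All directed paths from u to v with at most f arcs; a path is recorded as the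
  -- list of its arcs (target vertex, weight) in order.
  paths : Digraph → ℕ → Vertex → Vertex → List (List (Vertex × Carrier))
  paths D zero    u v = if u == v then [] ∷ [] else []
  paths D (suc f) u v =
    (if u == v then [] ∷ [] else [])
    ++ concatMap (λ { (w , x) → map ((w , x) ∷_) (paths D f w v) }) (D u)

  pathWeight : List (Vertex × Carrier) → Carrier
  pathWeight = foldr (λ { (_ , x) acc → x * acc }) 1#

  GFf : Digraph → ℕ → Vertex → Vertex → Carrier
  GFf D f u v = foldr _+_ 0# (map pathWeight (paths D f u v))

  -- In D^{C_N} every arc raises the rank (P_i^{(m)} ↦ 2m, Q_i^{(m)} ↦ 2m+1) and all
  -- ranks are ≤ 2N, so every directed path has at most 2N arcs: fuel 2N+1 enumerates
  -- all directed paths.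
  fuel : ℕ → ℕ
  fuel N = suc (2 ℕ.* N)

  -- Subgraph of D (of D^{C_N}) formed by the arcs of all directed paths from src to tgt:
  -- the arc x → y lies on such a path iff x is reachable from src and tgt from y.
  subgraphOnPaths : Digraph → ℕ → Vertex → Vertex → Digraph
  subgraphOnPaths D N src tgt x =
    filterᵇ (λ { (y , _) → not (null (paths D (fuel N) src x))
                            ∧ not (null (paths D (fuel N) y tgt)) }) (D x)

  DH : (r s t b c : ℕ → Carrier) → (ℕ → BlockType) → (k n : ℕ) → Digraph
  DH r s t b c τ k n =
    subgraphOnPaths (DC r s t b c τ N) N (P k k) (P N N)
    where N = 2 ℕ.* n ℕ.+ k

  GF-H : (r s t b c : ℕ → Carrier) → (ℕ → BlockType) → (k n : ℕ) → Vertex → Vertex → Carrier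
  GF-H r s t b c τ k n = GFf (DH r s t b c τ k n) (fuel (2 ℕ.* n ℕ.+ k))

module Submission where

-- Every arc of D^{C_N} raises the rank (2m at P_i^{(m)}, 2m+1 at Q_i^{(m)}), so generating
-- functions obey the first-arc recursion, and between vertices lying on paths from P_k^{(k)}
-- to P_N^{(N)} the subgraph D^{H_n} has the same generating functions as D^{C_N}.
-- Each block Type is designed so that the two-arc routes from P_i^{(m)} to P_i^{(m+1)},
-- P_{i+1}^{(m+1)}, P_{i+2}^{(m+1)} have total weights r_h, s_h, t_h with h = m - i. Hence
-- GF(P_i^{(m)}, P_B^{(B)}) counts weighted Motzkin paths of length B - m from height m - i
-- down to 0. Starting on the diagonal this count obeys the last-step recursion of the
-- Catalan-Stieltjes matrix, so it equals c_{i+j,0}.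

open import Defs
open import Algebra.Bundles using (CommutativeRing)
open import Data.Bool using (Bool; true; false; if_then_else_; _∧_; not; T)
open import Data.Bool.Properties using (T-≡; T-∧)
open import Data.Empty using (⊥-elim)
open import Data.List using (List; []; _∷_; _++_; map; concatMap; filterᵇ; foldr; null)
open import Data.List.Membership.Propositional using (_∈_; find; lose)
open import Data.List.Membership.Propositional.Properties
  using (∈-++⁺ˡ; ∈-++⁺ʳ; ∈-++⁻; ∈-concatMap⁺; ∈-concatMap⁻; ∈-map⁺; ∈-map⁻)
open import Data.List.Properties using (map-++)
open import Data.List.Relation.Unary.All as All using (All; []; _∷_)
open import Data.List.Relation.Unary.All.Properties using (++⁺)
open import Data.List.Relation.Unary.Any using (here; there)
open import Data.Nat using (ℕ; zero; suc; pred; _∸_; _<_; _≤_; s≤s; _≟_; _≤?_; _<?_)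
import Data.Nat as ℕ
open import Data.Nat.Properties as ℕₚ
  using ( ≡ᵇ⇒≡; ≡⇒≡ᵇ; <ᵇ⇒<; <-irrefl; <-trans; <-≤-trans; ≤-trans; ≤-refl; ≤-reflexive; <⇒≤; <⇒≢
        ; n≤1+n; m≤n⇒m≤1+n; m≤m+n; m≤n+m; m∸n≤m; ∸-monoʳ-≤; +-∸-assoc; m∸n+n≡m; n∸n≡0
        ; m≤n⇒m<n∨m≡n; pred[m∸n]≡m∸[1+n]; +-suc; *-monoʳ-≤; *-suc
        ; +-monoʳ-≤; m+n≤o⇒m≤o∸n )
open import Data.Nat.Tactic.RingSolver using (solve-∀)
open import Data.Product using (_×_; _,_; proj₁; proj₂; ∃)
open import Data.Sum using (_⊎_; inj₁; inj₂)
open import Function.Bundles using (module Equivalence)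
open import Relation.Nullary using (¬_; does)
open import Relation.Nullary.Decidable using (dec-true; dec-false)
open import Relation.Binary.PropositionalEquality as ≡ using (_≡_; _≢_)

==⇒≡ : ∀ {u v} → (u == v) ≡ true → u ≡ v
==⇒≡ {u} {v} eq = sound u v (Equivalence.from T-≡ eq)
  where
  sound : ∀ u v → T (u == v) → u ≡ v
  sound (P i m) (P i′ m′) t =
    let ti , tm = Equivalence.to T-∧ t in ≡.cong₂ P (≡ᵇ⇒≡ i i′ ti) (≡ᵇ⇒≡ m m′ tm)
  sound (Q i m) (Q i′ m′) t =
    let ti , tm = Equivalence.to T-∧ t in ≡.cong₂ Q (≡ᵇ⇒≡ i i′ ti) (≡ᵇ⇒≡ m m′ tm)

==-refl : ∀ u → (u == u) ≡ true
==-refl (P i m) = Equivalence.to T-≡ (Equivalence.from T-∧ (≡⇒≡ᵇ i i ≡.refl , ≡⇒≡ᵇ m m ≡.refl))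
==-refl (Q i m) = Equivalence.to T-≡ (Equivalence.from T-∧ (≡⇒≡ᵇ i i ≡.refl , ≡⇒≡ᵇ m m ≡.refl))

≢⇒==≡false : ∀ {u v} → u ≢ v → (u == v) ≡ false
≢⇒==≡false {u} {v} u≢v with u == v in eq
... | true  = ⊥-elim (u≢v (==⇒≡ eq))
... | false = ≡.refl

∈⇒nonNull : ∀ {a} {A : Set a} {x : A} {xs} → x ∈ xs → not (null xs) ≡ true
∈⇒nonNull (here _)  = ≡.refl
∈⇒nonNull (there _) = ≡.refl

module GeneratingFunction {a ℓ} (R : CommutativeRing a ℓ) where
  open CommutativeRing R
  open import Relation.Binary.Reasoning.Setoid setoid

  δ : Vertex → Vertex → Carrier
  δ u v = if u == v then 1# else 0#

  sum : List Carrier → Carrier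
  sum = foldr _+_ 0#

  sum-++ : ∀ xs ys → sum (xs ++ ys) ≈ sum xs + sum ys
  sum-++ []       ys = sym (+-identityˡ _)
  sum-++ (x ∷ xs) ys = trans (+-congˡ (sum-++ xs ys)) (sym (+-assoc _ _ _))

  trivialPaths : Vertex → Vertex → List (List (Vertex × Carrier))
  trivialPaths u v = if u == v then [] ∷ [] else []

  ∈-trivialPaths⇒≡ : ∀ {u v} {p : List (Vertex × Carrier)} → p ∈ trivialPaths u v → u ≡ v
  ∈-trivialPaths⇒≡ {u} {v} p∈ with u == v in eq
  ∈-trivialPaths⇒≡ p∈ | true = ==⇒≡ eq

  []∈trivialPaths : ∀ u → [] ∈ trivialPaths u u
  []∈trivialPaths u rewrite ==-refl u = here ≡.refl

  infix 4 _⊢_⇝[_]_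
  record _⊢_⇝[_]_ (D : Digraph R) (u : Vertex) (f : ℕ) (v : Vertex) : Set a where
    constructor path
    field
      {arcs} : List (Vertex × Carrier)
      arcs∈  : arcs ∈ paths R D f u v

  module _ (D : Digraph R) where

    extensions : ℕ → Vertex → Vertex × Carrier → List (List (Vertex × Carrier))
    extensions f v = λ { (w , x) → map ((w , x) ∷_) (paths R D f w v) }

    arcTerm : ℕ → Vertex → Vertex × Carrier → Carrier
    arcTerm f v (w , x) = x * GFf R D f w v

    outSum : ℕ → Vertex → List (Vertex × Carrier) → Carrier
    outSum f v []       = 0#
    outSum f v (e ∷ es) = arcTerm f v e + outSum f v es

    GFf-zero : ∀ u v → GFf R D 0 u v ≈ δ u v
    GFf-zero u v with u == v
    ... | true  = +-identityʳ 1#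
    ... | false = refl

    sum-extensions : ∀ f v es → sum (map (pathWeight R) (concatMap (extensions f v) es)) ≈ outSum f v es
    sum-extensions f v []       = refl
    sum-extensions f v (e ∷ es) = begin
      sum (map (pathWeight R) (extensions f v e ++ concatMap (extensions f v) es))
        ≡⟨ ≡.cong sum (map-++ (pathWeight R) (extensions f v e) _) ⟩
      sum (map (pathWeight R) (extensions f v e) ++ map (pathWeight R) (concatMap (extensions f v) es))
        ≈⟨ sum-++ (map (pathWeight R) (extensions f v e)) _ ⟩
      sum (map (pathWeight R) (map (e ∷_) (paths R D f (proj₁ e) v)))
        + sum (map (pathWeight R) (concatMap (extensions f v) es))
        ≈⟨ +-cong (sum-prefixed (paths R D f (proj₁ e) v)) (sum-extensions f v es) ⟩
      arcTerm f v e + outSum f v es ∎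
      where
      sum-prefixed : ∀ ps → sum (map (pathWeight R) (map (e ∷_) ps)) ≈ proj₂ e * sum (map (pathWeight R) ps)
      sum-prefixed []       = sym (zeroʳ _)
      sum-prefixed (p ∷ ps) = trans (+-congˡ (sum-prefixed ps)) (sym (distribˡ _ _ _))

    GFf-suc : ∀ f u v → GFf R D (suc f) u v ≈ δ u v + outSum f v (D u)
    GFf-suc f u v = begin
      sum (map (pathWeight R) (trivialPaths u v ++ concatMap (extensions f v) (D u)))
        ≡⟨ ≡.cong sum (map-++ (pathWeight R) (trivialPaths u v) _) ⟩
      sum (map (pathWeight R) (trivialPaths u v) ++ map (pathWeight R) (concatMap (extensions f v) (D u)))
        ≈⟨ sum-++ (map (pathWeight R) (trivialPaths u v)) _ ⟩
      GFf R D 0 u v + sum (map (pathWeight R) (concatMap (extensions f v) (D u)))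
        ≈⟨ +-cong (GFf-zero u v) (sum-extensions f v (D u)) ⟩
      δ u v + outSum f v (D u) ∎

    GFf-suc-≢ : ∀ f {u v} → u ≢ v → GFf R D (suc f) u v ≈ outSum f v (D u)
    GFf-suc-≢ f {u} {v} u≢v = begin
      GFf R D (suc f) u v      ≈⟨ GFf-suc f u v ⟩
      δ u v + outSum f v (D u) ≡⟨ ≡.cong (λ b → (if b then 1# else 0#) + outSum f v (D u)) (≢⇒==≡false u≢v) ⟩
      0# + outSum f v (D u)    ≈⟨ +-identityˡ _ ⟩
      outSum f v (D u)         ∎

    ⇝-zero : ∀ {u v} → D ⊢ u ⇝[ 0 ] v → u ≡ v
    ⇝-zero (path p∈) = ∈-trivialPaths⇒≡ p∈

    ⇝-refl : ∀ f u → D ⊢ u ⇝[ f ] u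
    ⇝-refl zero    u = path ([]∈trivialPaths u)
    ⇝-refl (suc f) u = path (∈-++⁺ˡ ([]∈trivialPaths u))

    ⇝-step : ∀ {f u v e} → e ∈ D u → D ⊢ proj₁ e ⇝[ f ] v → D ⊢ u ⇝[ suc f ] v
    ⇝-step {f} {u} {v} {e} e∈ (path p∈) =
      path (∈-++⁺ʳ (trivialPaths u v) (∈-concatMap⁺ (extensions f v) (lose e∈ (∈-map⁺ (e ∷_) p∈))))

    ⇝-inv : ∀ {f u v} → D ⊢ u ⇝[ suc f ] v → u ≡ v ⊎ ∃ λ e → e ∈ D u × D ⊢ proj₁ e ⇝[ f ] v
    ⇝-inv {f} {u} {v} (path p∈) with ∈-++⁻ (trivialPaths u v) p∈
    ... | inj₁ p∈trivial = inj₁ (∈-trivialPaths⇒≡ p∈trivial)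
    ... | inj₂ p∈extended with find (∈-concatMap⁻ (extensions f v) {xs = D u} p∈extended)
    ... | e , e∈ , p∈e with ∈-map⁻ (e ∷_) p∈e
    ... | q , q∈ , _ = inj₂ (e , e∈ , path q∈)

    ⇝-mono : ∀ {f g u v} → f ≤ g → D ⊢ u ⇝[ f ] v → D ⊢ u ⇝[ g ] v
    ⇝-mono {zero} {g} f≤g u⇝v with ⇝-zero u⇝v
    ... | ≡.refl = ⇝-refl g _
    ⇝-mono {suc f} {suc g} (s≤s f≤g) u⇝v with ⇝-inv u⇝v
    ... | inj₁ ≡.refl           = ⇝-refl (suc g) _
    ... | inj₂ (e , e∈ , e⇝v) = ⇝-step e∈ (⇝-mono f≤g e⇝v)

    ⇝-trans : ∀ {f g u v w} → D ⊢ u ⇝[ f ] v → D ⊢ v ⇝[ g ] w → D ⊢ u ⇝[ f ℕ.+ g ] w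
    ⇝-trans {zero} u⇝v v⇝w with ⇝-zero u⇝v
    ... | ≡.refl = v⇝w
    ⇝-trans {suc f} {g} u⇝v v⇝w with ⇝-inv u⇝v
    ... | inj₁ ≡.refl           = ⇝-mono (m≤n+m g (suc f)) v⇝w
    ... | inj₂ (e , e∈ , e⇝v) = ⇝-step e∈ (⇝-trans e⇝v v⇝w)

    GFf-unreachable : ∀ {f u v} → ¬ D ⊢ u ⇝[ f ] v → GFf R D f u v ≈ 0#
    GFf-unreachable {f} {u} {v} u↛v with paths R D f u v in eq
    ... | []    = refl
    ... | p ∷ _ = ⊥-elim (u↛v (path (≡.subst (p ∈_) (≡.sym eq) (here ≡.refl))))

    outSum-unreachable : ∀ {f v} es → All (λ e → ¬ D ⊢ proj₁ e ⇝[ f ] v) es → outSum f v es ≈ 0#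
    outSum-unreachable []       []          = refl
    outSum-unreachable {f} {v} (e ∷ es) (e↛v ∷ rest) = begin
      proj₂ e * GFf R D f (proj₁ e) v + outSum f v es
        ≈⟨ +-cong (*-congˡ (GFf-unreachable e↛v)) (outSum-unreachable es rest) ⟩
      proj₂ e * 0# + 0#                                ≈⟨ +-identityʳ _ ⟩
      proj₂ e * 0#                                     ≈⟨ zeroʳ _ ⟩
      0#                                               ∎

  outSum-filterᵇ : ∀ (D′ D : Digraph R) f v (keep : Vertex × Carrier → Bool) es →
                   (∀ {e} → e ∈ es → keep e ≡ true → arcTerm D′ f v e ≈ arcTerm D f v e) →
                   (∀ {e} → e ∈ es → keep e ≡ false → arcTerm D f v e ≈ 0#) →
                   outSum D′ f v (filterᵇ keep es) ≈ outSum D f v es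
  outSum-filterᵇ D′ D f v keep []       kept dropped = refl
  outSum-filterᵇ D′ D f v keep (e ∷ es) kept dropped with keep e in eq
  ... | true  = +-cong (kept (here ≡.refl) eq) rest
    where rest = outSum-filterᵇ D′ D f v keep es (λ e∈ → kept (there e∈)) (λ e∈ → dropped (there e∈))
  ... | false = begin
    outSum D′ f v (filterᵇ keep es)      ≈⟨ rest ⟩
    outSum D f v es                      ≈⟨ +-identityˡ _ ⟨
    0# + outSum D f v es                 ≈⟨ +-congʳ (dropped (here ≡.refl) eq) ⟨
    arcTerm D f v e + outSum D f v es    ∎
    where rest = outSum-filterᵇ D′ D f v keep es (λ e∈ → kept (there e∈)) (λ e∈ → dropped (there e∈))

module Ranked {a ℓ} (R : CommutativeRing a ℓ) (D : Digraph R) (ρ : Vertex → ℕ)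
               (ρ-increasing : ∀ u → All (λ e → ρ u < ρ (proj₁ e)) (D u)) where
  open CommutativeRing R
  open GeneratingFunction R
  open import Relation.Binary.Reasoning.Setoid setoid

  ⇝-rank : ∀ {f u v} → D ⊢ u ⇝[ f ] v → ρ u ≤ ρ v
  ⇝-rank {zero} u⇝v with ⇝-zero D u⇝v
  ... | ≡.refl = ≤-refl
  ⇝-rank {suc f} {u} u⇝v with ⇝-inv D u⇝v
  ... | inj₁ ≡.refl           = ≤-refl
  ... | inj₂ (e , e∈ , e⇝v) = <⇒≤ (<-≤-trans (All.lookup (ρ-increasing u) e∈) (⇝-rank e⇝v))

  ⇝-tight : ∀ {f u v} → D ⊢ u ⇝[ f ] v → D ⊢ u ⇝[ ρ v ∸ ρ u ] v
  ⇝-tight {zero} {u} u⇝v with ⇝-zero D u⇝v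
  ... | ≡.refl = ⇝-refl D _ u
  ⇝-tight {suc f} {u} {v} u⇝v with ⇝-inv D u⇝v
  ... | inj₁ ≡.refl           = ⇝-refl D _ u
  ... | inj₂ (e , e∈ , e⇝v) = ⇝-mono D shorter (⇝-step D e∈ (⇝-tight e⇝v))
    where
    shorter : suc (ρ v ∸ ρ (proj₁ e)) ≤ ρ v ∸ ρ u
    shorter = ≤-trans (s≤s (∸-monoʳ-≤ (ρ v) (All.lookup (ρ-increasing u) e∈)))
                      (≤-reflexive (≡.sym (+-∸-assoc 1 (≤-trans (All.lookup (ρ-increasing u) e∈) (⇝-rank e⇝v)))))

  ⇝-within : ∀ {b f u v} → ρ v ≤ b → D ⊢ u ⇝[ f ] v → D ⊢ u ⇝[ b ] v
  ⇝-within {u = u} {v} ρv≤b u⇝v = ⇝-mono D (≤-trans (m∸n≤m (ρ v) (ρ u)) ρv≤b) (⇝-tight u⇝v)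

  GFf-sameRank : ∀ f u v → ρ u ≡ ρ v → GFf R D f u v ≈ δ u v
  GFf-sameRank zero    u v _      = GFf-zero D u v
  GFf-sameRank (suc f) u v ρu≡ρv = begin
    GFf R D (suc f) u v        ≈⟨ GFf-suc D f u v ⟩
    δ u v + outSum D f v (D u) ≈⟨ +-congˡ (outSum-unreachable D (D u) unreachable) ⟩
    δ u v + 0#                 ≈⟨ +-identityʳ _ ⟩
    δ u v                      ∎
    where
    overshoots : ∀ {e : Vertex × Carrier} → ρ u < ρ (proj₁ e) → ¬ D ⊢ proj₁ e ⇝[ f ] v
    overshoots ρu<ρe e⇝v = <-irrefl ρu≡ρv (<-≤-trans ρu<ρe (⇝-rank e⇝v))
    unreachable : All (λ e → ¬ D ⊢ proj₁ e ⇝[ f ] v) (D u)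
    unreachable = All.map (λ {e} → overshoots {e}) (ρ-increasing u)

module SubgraphOnPaths {a ℓ} (R : CommutativeRing a ℓ) (D : Digraph R) (ρ : Vertex → ℕ) (N : ℕ)
         (ρ-increasing : ∀ u → All (λ e → ρ u < ρ (proj₁ e)) (D u))
         (ρ-bounded : ∀ u → All (λ e → ρ (proj₁ e) ≤ fuel R N) (D u))
         (src tgt : Vertex) (ρ-tgt : ρ tgt ≤ fuel R N) where
  open CommutativeRing R
  open GeneratingFunction R
  open Ranked R D ρ ρ-increasing
  open import Relation.Binary.Reasoning.Setoid setoid

  H : Digraph R
  H = subgraphOnPaths R D N src tgt

  reachable? : Vertex → Vertex → Bool
  reachable? u v = not (null (paths R D (fuel R N) u v))

  reachable?-true : ∀ {u v} → D ⊢ u ⇝[ fuel R N ] v → reachable? u v ≡ true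
  reachable?-true (path p∈) = ∈⇒nonNull p∈

  GFf-subgraphOnPaths : ∀ {g} f {u v} → D ⊢ src ⇝[ fuel R N ] u → D ⊢ v ⇝[ g ] tgt →
                        GFf R H f u v ≈ GFf R D f u v
  GFf-subgraphOnPaths zero _ _ = refl
  GFf-subgraphOnPaths {g} (suc f) {u} {v} src⇝u v⇝tgt = begin
    GFf R H (suc f) u v        ≈⟨ GFf-suc H f u v ⟩
    δ u v + outSum H f v (H u) ≈⟨ +-congˡ (outSum-filterᵇ H D f v _ (D u) kept dropped) ⟩
    δ u v + outSum D f v (D u) ≈⟨ GFf-suc D f u v ⟨
    GFf R D (suc f) u v        ∎
    where
    kept : ∀ {e} → e ∈ D u → reachable? src u ∧ reachable? (proj₁ e) tgt ≡ true → arcTerm H f v e ≈ arcTerm D f v e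
    kept {e} e∈ _ = *-congˡ (GFf-subgraphOnPaths f src⇝e v⇝tgt)
      where
      src⇝e : D ⊢ src ⇝[ fuel R N ] proj₁ e
      src⇝e = ⇝-within (All.lookup (ρ-bounded u) e∈) (⇝-trans D src⇝u (⇝-step D e∈ (⇝-refl D 0 (proj₁ e))))
    dropped : ∀ {e} → e ∈ D u → reachable? src u ∧ reachable? (proj₁ e) tgt ≡ false → arcTerm D f v e ≈ 0#
    dropped {e} _ not-kept = trans (*-congˡ (GFf-unreachable D e↛v)) (zeroʳ _)
      where
      e↛tgt : reachable? (proj₁ e) tgt ≡ false
      e↛tgt = ≡.trans (≡.cong (_∧ reachable? (proj₁ e) tgt) (≡.sym (reachable?-true src⇝u))) not-kept
      e↛v : ¬ D ⊢ proj₁ e ⇝[ f ] v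
      e↛v e⇝v with ≡.trans (≡.sym (reachable?-true (⇝-within ρ-tgt (⇝-trans D e⇝v v⇝tgt)))) e↛tgt
      ... | ()

All-if : ∀ {a p} {A : Set a} {Pr : A → Set p} (c : Bool) {xs : List A} →
         (T c → All Pr xs) → All Pr (if c then xs else [])
All-if true  all = all _
All-if false _   = []

rank : Vertex → ℕ
rank (P i m) = 2 ℕ.* m
rank (Q i m) = suc (2 ℕ.* m)

module DCProperties {a ℓ} (R : CommutativeRing a ℓ) (r s t b c : ℕ → CommutativeRing.Carrier R)
                (τ : ℕ → BlockType) (N : ℕ) where
  open CommutativeRing R using (Carrier)
  open GeneratingFunction R using (_⊢_⇝[_]_; ⇝-refl; ⇝-step)

  D : Digraph R
  D = DC R r s t b c τ N

  weight : ArcKind → ℕ → ℕ → Carrier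
  weight κ m i = blockWeight R r s t b c (τ m) κ m i

  2m<1+2m : ∀ m → 2 ℕ.* m < suc (2 ℕ.* m)
  2m<1+2m m = ≤-refl

  1+2m<2[1+m] : ∀ m → suc (2 ℕ.* m) < 2 ℕ.* suc m
  1+2m<2[1+m] m = ≤-reflexive (≡.sym (*-suc 2 m))

  2m<2[1+m] : ∀ m → 2 ℕ.* m < 2 ℕ.* suc m
  2m<2[1+m] m = <-trans (2m<1+2m m) (1+2m<2[1+m] m)

  2[1+m]≤2N : ∀ {m} → m < N → 2 ℕ.* suc m ≤ 2 ℕ.* N
  2[1+m]≤2N m<N = *-monoʳ-≤ 2 m<N

  1+2m≤2N : ∀ {m} → m < N → suc (2 ℕ.* m) ≤ 2 ℕ.* N
  1+2m≤2N {m} m<N = <⇒≤ (<-≤-trans (1+2m<2[1+m] m) (2[1+m]≤2N m<N))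

  D-ranks : ∀ u → All (λ e → rank u < rank (proj₁ e) × rank (proj₁ e) ≤ 2 ℕ.* N) (D u)
  D-ranks (P i m) = All-if (does (m <? N)) λ m<N? → let m<N = <ᵇ⇒< m N m<N? in
    ++⁺ (All-if (does (i ≤? suc m)) λ _ → (2m<1+2m m , 1+2m≤2N m<N) ∷ [])
        (++⁺ (All-if (does (i ≤? m)) λ _ → (2m<1+2m m , 1+2m≤2N m<N) ∷ (2m<2[1+m] m , 2[1+m]≤2N m<N) ∷ [])
             (All-if (does (suc (suc m) ≤? i) ∧ does (i ≤? N)) λ _ → (2m<2[1+m] m , 2[1+m]≤2N m<N) ∷ []))
  D-ranks (Q i m) = All-if (does (m <? N)) λ m<N? → let m<N = <ᵇ⇒< m N m<N? in
    ++⁺ (All-if (does (i ≤? suc m)) λ _ → (1+2m<2[1+m] m , 2[1+m]≤2N m<N) ∷ [])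
        (All-if (does (i ≤? m)) λ _ → (1+2m<2[1+m] m , 2[1+m]≤2N m<N) ∷ [])

  rank-increasing : ∀ u → All (λ e → rank u < rank (proj₁ e)) (D u)
  rank-increasing u = All.map proj₁ (D-ranks u)

  rank-bounded : ∀ u → All (λ e → rank (proj₁ e) ≤ fuel R N) (D u)
  rank-bounded u = All.map (λ bounds → ≤-trans (proj₂ bounds) (n≤1+n _)) (D-ranks u)

  D-P : ∀ {i m} → i ≤ m → m < N →
        D (P i m) ≡ (Q i m , weight PQ m i) ∷ (Q (suc i) m , weight PQ' m i) ∷ (P (suc i) (suc m) , weight PP' m i) ∷ []
  D-P {i} {m} i≤m m<N
    rewrite dec-true (m <? N) m<N | dec-true (i ≤? suc m) (m≤n⇒m≤1+n i≤m) | dec-true (i ≤? m) i≤m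
          | dec-false (suc (suc m) ≤? i) (λ 2+m≤i → <-irrefl ≡.refl (≤-trans 2+m≤i (m≤n⇒m≤1+n i≤m)))
    = ≡.refl

  D-Q : ∀ {i m} → i ≤ m → m < N → D (Q i m) ≡ (P i (suc m) , weight QP m i) ∷ (P (suc i) (suc m) , weight QP' m i) ∷ []
  D-Q {i} {m} i≤m m<N
    rewrite dec-true (m <? N) m<N | dec-true (i ≤? suc m) (m≤n⇒m≤1+n i≤m) | dec-true (i ≤? m) i≤m
    = ≡.refl

  D-Q-top : ∀ {m} → m < N → D (Q (suc m) m) ≡ (P (suc m) (suc m) , weight QP m (suc m)) ∷ []
  D-Q-top {m} m<N
    rewrite dec-true (m <? N) m<N | dec-true (suc m ≤? suc m) ≤-refl | dec-false (suc m ≤? m) (<-irrefl ≡.refl)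
    = ≡.refl

  diagonal⇝ : ∀ {x y} → x ≤ y → y ≤ N → D ⊢ P x x ⇝[ y ∸ x ] P y y
  diagonal⇝ {x} {y} x≤y y≤N =
    ≡.subst (λ z → D ⊢ P x x ⇝[ y ∸ x ] P z z) (m∸n+n≡m x≤y)
            (climb (y ∸ x) (≤-trans (≤-reflexive (m∸n+n≡m x≤y)) y≤N))
    where
    climb : ∀ d {m} → d ℕ.+ m ≤ N → D ⊢ P m m ⇝[ d ] P (d ℕ.+ m) (d ℕ.+ m)
    climb zero    {m} _     = ⇝-refl D 0 (P m m)
    climb (suc d) {m} d+m<N =
      ⇝-step D PP′∈ (≡.subst (λ z → D ⊢ P (suc m) (suc m) ⇝[ d ] P z z) (+-suc d m) (climb d d+1+m≤N))
      where
      m<N : m < N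
      m<N = <-≤-trans (s≤s (m≤n+m m d)) d+m<N
      d+1+m≤N : d ℕ.+ suc m ≤ N
      d+1+m≤N = ≤-trans (≤-reflexive (+-suc d m)) d+m<N
      PP′∈ : (P (suc m) (suc m) , weight PP' m m) ∈ D (P m m)
      PP′∈ = ≡.subst ((P (suc m) (suc m) , weight PP' m m) ∈_) (≡.sym (D-P ≤-refl m<N)) (there (there (here ≡.refl)))

module Motzkin {a ℓ} (R : CommutativeRing a ℓ) (r s t : ℕ → CommutativeRing.Carrier R) where
  open CommutativeRing R
  open import Algebra.Solver.Ring.NaturalCoefficients.Default commutativeSemiring using (solve; _:=_; _:+_; _:*_)
  open import Relation.Binary.Reasoning.Setoid setoid

  kronecker : ℕ → ℕ → Carrier
  kronecker zero    zero    = 1#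
  kronecker zero    (suc _) = 0#
  kronecker (suc _) zero    = 0#
  kronecker (suc x) (suc y) = kronecker x y

  -- Weighted Motzkin paths of length L from height x to height y: an up-step
  -- from height h weighs r h, a level step s h and a down-step t h.
  motzkin : ℕ → ℕ → ℕ → Carrier
  motzkin zero    x y = kronecker x y
  motzkin (suc L) x y = r x * motzkin L (suc x) y + s x * motzkin L x y + t0 R t x * motzkin L (pred x) y

  kronecker-swap : ∀ (g : ℕ → Carrier) x y → g x * kronecker x y ≈ g y * kronecker x y
  kronecker-swap g zero    zero    = refl
  kronecker-swap g zero    (suc y) = trans (zeroʳ _) (sym (zeroʳ _))
  kronecker-swap g (suc x) zero    = trans (zeroʳ _) (sym (zeroʳ _))
  kronecker-swap g (suc x) (suc y) = kronecker-swap (λ z → g (suc z)) x y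

  interchange : ∀ α₁ α₂ α₃ β₁ β₂ β₃ w₁₁ w₁₂ w₁₃ w₂₁ w₂₂ w₂₃ w₃₁ w₃₂ w₃₃ →
    α₁ * (β₁ * w₁₁ + β₂ * w₁₂ + β₃ * w₁₃)
      + α₂ * (β₁ * w₂₁ + β₂ * w₂₂ + β₃ * w₂₃)
      + α₃ * (β₁ * w₃₁ + β₂ * w₃₂ + β₃ * w₃₃)
    ≈ β₁ * (α₁ * w₁₁ + α₂ * w₂₁ + α₃ * w₃₁)
      + β₂ * (α₁ * w₁₂ + α₂ * w₂₂ + α₃ * w₃₂)
      + β₃ * (α₁ * w₁₃ + α₂ * w₂₃ + α₃ * w₃₃)
  interchange = solve 15 (λ α₁ α₂ α₃ β₁ β₂ β₃ w₁₁ w₁₂ w₁₃ w₂₁ w₂₂ w₂₃ w₃₁ w₃₂ w₃₃ →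
      (α₁ :* (β₁ :* w₁₁ :+ β₂ :* w₁₂ :+ β₃ :* w₁₃)
        :+ α₂ :* (β₁ :* w₂₁ :+ β₂ :* w₂₂ :+ β₃ :* w₂₃)
        :+ α₃ :* (β₁ :* w₃₁ :+ β₂ :* w₃₂ :+ β₃ :* w₃₃))
    := (β₁ :* (α₁ :* w₁₁ :+ α₂ :* w₂₁ :+ α₃ :* w₃₁)
        :+ β₂ :* (α₁ :* w₁₂ :+ α₂ :* w₂₂ :+ α₃ :* w₃₂)
        :+ β₃ :* (α₁ :* w₁₃ :+ α₂ :* w₂₃ :+ α₃ :* w₃₃)))
    refl

  motzkin-lastStep : ∀ L x y →
    motzkin (suc L) x y ≈ rm1 R r y * motzkin L x (pred y) + s y * motzkin L x y + t (suc y) * motzkin L x (suc y)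
  motzkin-lastStep zero x y = +-cong (+-cong (up x y) (kronecker-swap s x y)) (down x y)
    where
    up : ∀ x y → r x * kronecker (suc x) y ≈ rm1 R r y * kronecker x (pred y)
    up x zero    = trans (zeroʳ _) (sym (zeroˡ _))
    up x (suc y) = kronecker-swap r x y
    down : ∀ x y → t0 R t x * kronecker (pred x) y ≈ t (suc y) * kronecker x (suc y)
    down zero    y = trans (zeroˡ _) (sym (zeroʳ _))
    down (suc x) y = kronecker-swap (λ z → t (suc z)) x y
  motzkin-lastStep (suc L) x y = begin
    r x * motzkin (suc L) (suc x) y + s x * motzkin (suc L) x y + t0 R t x * motzkin (suc L) (pred x) y
      ≈⟨ +-cong (+-cong (*-congˡ (motzkin-lastStep L (suc x) y)) (*-congˡ (motzkin-lastStep L x y)))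
                (*-congˡ (motzkin-lastStep L (pred x) y)) ⟩
    _ ≈⟨ interchange (r x) (s x) (t0 R t x) (rm1 R r y) (s y) (t (suc y)) _ _ _ _ _ _ _ _ _ ⟩
    rm1 R r y * motzkin (suc L) x (pred y) + s y * motzkin (suc L) x y + t (suc y) * motzkin (suc L) x (suc y) ∎

  catalan≈motzkin : ∀ i j → catalan R r s t i j ≈ motzkin i 0 j
  catalan≈motzkin zero    zero    = refl
  catalan≈motzkin zero    (suc j) = refl
  catalan≈motzkin (suc i) zero    = begin
    s 0 * catalan R r s t i 0 + t 1 * catalan R r s t i 1
      ≈⟨ +-cong (*-congˡ (catalan≈motzkin i 0)) (*-congˡ (catalan≈motzkin i 1)) ⟩
    s 0 * motzkin i 0 0 + t 1 * motzkin i 0 1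
      ≈⟨ +-congʳ (+-identityˡ _) ⟨
    0# + s 0 * motzkin i 0 0 + t 1 * motzkin i 0 1
      ≈⟨ +-congʳ (+-congʳ (zeroˡ _)) ⟨
    0# * motzkin i 0 0 + s 0 * motzkin i 0 0 + t 1 * motzkin i 0 1
      ≈⟨ motzkin-lastStep i 0 0 ⟨
    motzkin (suc i) 0 0 ∎
  catalan≈motzkin (suc i) (suc j) = trans
    (+-cong (+-cong (*-congˡ (catalan≈motzkin i j)) (*-congˡ (catalan≈motzkin i (suc j))))
            (*-congˡ (catalan≈motzkin i (suc (suc j)))))
    (sym (motzkin-lastStep i 0 (suc j)))

∸≡suc∸suc : ∀ {i m} → i < m → m ∸ i ≡ suc (m ∸ suc i)
∸≡suc∸suc i<m = +-∸-assoc 1 i<m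

module BlockWeights {a ℓ} (R : CommutativeRing a ℓ) (r s t b c : ℕ → CommutativeRing.Carrier R) where
  open CommutativeRing R
  open import Algebra.Properties.AbelianGroup +-abelianGroup using (xyx⁻¹≈y)
  open import Algebra.Solver.Ring.NaturalCoefficients.Default commutativeSemiring using (solve; _:=_; _:+_; _:*_)
  open import Relation.Binary.Reasoning.Setoid setoid

  weight : BlockType → ArcKind → ℕ → ℕ → Carrier
  weight T κ m i = blockWeight R r s t b c T κ m i

  Admissible : BlockType → Set ℓ
  Admissible T = T ≡ type5 → Type5Admissible R r s t b c

  -- Total weights of the two-arc routes from P_i^{(m)} to P_i^{(m+1)}, P_{i+1}^{(m+1)}, P_{i+2}^{(m+1)}.
  upWeight levelWeight downWeight : BlockType → ℕ → ℕ → Carrier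
  upWeight    T m i = weight T PQ m i * weight T QP m i
  levelWeight T m i = weight T PQ m i * weight T QP' m i + weight T PQ' m i * weight T QP m (suc i) + weight T PP' m i
  downWeight  T m i = weight T PQ' m i * weight T QP' m (suc i)

  x+[y-x]≈y : ∀ x y → x + (y + - x) ≈ y
  x+[y-x]≈y x y = trans (sym (+-assoc x y (- x))) (xyx⁻¹≈y x y)

  cancel₁ : ∀ {w x z} → w ≈ x → w + (z + - x) ≈ z
  cancel₁ {x = x} {z} w≈x = trans (+-congʳ w≈x) (x+[y-x]≈y x z)

  cancel₂ : ∀ {w x y z} → w ≈ x + y → w + (z + - x + - y) ≈ z
  cancel₂ {x = x} {y} {z} w≈x+y = begin
    _ + (z + - x + - y)         ≈⟨ +-congʳ w≈x+y ⟩
    x + y + (z + - x + - y)     ≈⟨ +-assoc x y _ ⟩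
    x + (y + (z + - x + - y))   ≈⟨ +-congˡ (x+[y-x]≈y y (z + - x)) ⟩
    x + (z + - x)               ≈⟨ x+[y-x]≈y x z ⟩
    z                           ∎

  upWeight≈r : ∀ T {m i} → Admissible T → i ≤ m → upWeight T m i ≈ r (m ∸ i)
  upWeight≈r type1 {m} {i} _ i≤m rewrite dec-true (i ≤? m) i≤m = *-identityʳ _
  upWeight≈r type2 {m} {i} _ i≤m rewrite dec-true (i ≤? m) i≤m = *-identityˡ _
  upWeight≈r type3 {m} {i} _ i≤m rewrite dec-true (i ≤? m) i≤m = *-identityˡ _
  upWeight≈r type4 {m} {i} _ i≤m rewrite dec-true (i ≤? m) i≤m = *-identityʳ _
  upWeight≈r type5 {m} {i} adm _ = trans (*-identityˡ 1#) (sym (proj₁ (adm ≡.refl (m ∸ i))))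

  levelWeight≈s : ∀ T {m i} → Admissible T → i ≤ m → levelWeight T m i ≈ s (m ∸ i)
  levelWeight≈s type1 {m} {i} _ i≤m rewrite dec-true (i ≤? m) i≤m =
    cancel₂ (+-cong (*-identityʳ _) (*-identityʳ _))
  levelWeight≈s type2 {m} {i} _ i≤m with m≤n⇒m<n∨m≡n i≤m
  ... | inj₁ i<m rewrite dec-false (i ≟ m) (<⇒≢ i<m) | dec-true (suc i ≤? m) i<m | ∸≡suc∸suc i<m =
    cancel₂ (trans (+-comm _ _) (+-cong (*-identityˡ _) (*-identityˡ _)))
  ... | inj₂ ≡.refl rewrite dec-true (i ≟ i) ≡.refl | dec-false (suc i ≤? i) (<-irrefl ≡.refl) | n∸n≡0 i =
    cancel₂ (trans (+-comm _ _) (+-cong (zeroˡ _) (*-identityˡ _)))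
  levelWeight≈s type3 {m} {i} _ i≤m with m≤n⇒m<n∨m≡n i≤m
  ... | inj₁ i<m rewrite dec-true (suc i ≤? m) i<m | ∸≡suc∸suc i<m =
    cancel₂ (trans (+-comm _ _) (+-cong (*-comm _ _) (*-identityˡ _)))
  ... | inj₂ ≡.refl rewrite dec-false (suc i ≤? i) (<-irrefl ≡.refl) | n∸n≡0 i =
    cancel₂ (trans (+-comm _ _) (+-cong (trans (zeroˡ _) (sym (zeroˡ _))) (*-identityˡ _)))
  levelWeight≈s type4 {m} {i} _ i≤m with m≤n⇒m<n∨m≡n i≤m
  ... | inj₁ i<m rewrite dec-true (i ≤? m) i≤m | dec-false (i ≟ m) (<⇒≢ i<m) | dec-true (i <? m) i<m =
    cancel₂ (+-congˡ (*-identityˡ _))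
  ... | inj₂ ≡.refl rewrite dec-true (i ≤? i) ≤-refl | dec-true (i ≟ i) ≡.refl | dec-false (i <? i) (<-irrefl ≡.refl)
                          | n∸n≡0 i =
    cancel₁ (trans (+-congˡ (zeroˡ _)) (+-identityʳ _))
  levelWeight≈s type5 {m} {i} adm _ = begin
    1# * c (m ∸ i) + b (m ∸ i) * 1# + 0# ≈⟨ +-identityʳ _ ⟩
    1# * c (m ∸ i) + b (m ∸ i) * 1#      ≈⟨ +-cong (*-identityˡ _) (*-identityʳ _) ⟩
    c (m ∸ i) + b (m ∸ i)                ≈⟨ +-comm _ _ ⟩
    b (m ∸ i) + c (m ∸ i)                ≈⟨ proj₁ (proj₂ (adm ≡.refl (m ∸ i))) ⟨
    s (m ∸ i)                            ∎

  downWeight≈t : ∀ T {m i} → Admissible T → i < m → downWeight T m i ≈ t0 R t (m ∸ i)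
  downWeight≈t type1 {m} {i} _ i<m rewrite ∸≡suc∸suc i<m = *-identityʳ _
  downWeight≈t type2 {m} {i} _ i<m rewrite dec-false (i ≟ m) (<⇒≢ i<m) | ∸≡suc∸suc i<m = *-identityˡ _
  downWeight≈t type3 {m} {i} _ i<m rewrite ∸≡suc∸suc i<m = *-identityʳ _
  downWeight≈t type4 {m} {i} _ i<m rewrite dec-false (i ≟ m) (<⇒≢ i<m) | ∸≡suc∸suc i<m = *-identityˡ _
  downWeight≈t type5 {m} {i} adm i<m rewrite ∸≡suc∸suc i<m = sym (proj₂ (proj₂ (adm ≡.refl (m ∸ suc i))))

  -- X, Y, Z are the values at P_i^{(m+1)}, P_{i+1}^{(m+1)}, P_{i+2}^{(m+1)}.
  throughBlock : BlockType → ℕ → ℕ → Carrier → Carrier → Carrier → Carrier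
  throughBlock T m i X Y Z =
    weight T PQ m i * (weight T QP m i * X + weight T QP' m i * Y)
    + weight T PQ' m i * (weight T QP m (suc i) * Y + weight T QP' m (suc i) * Z)
    + weight T PP' m i * Y

  throughTopBlock : BlockType → ℕ → Carrier → Carrier → Carrier
  throughTopBlock T m X Y =
    weight T PQ m m * (weight T QP m m * X + weight T QP' m m * Y)
    + weight T PQ' m m * (weight T QP m (suc m) * Y)
    + weight T PP' m m * Y

  throughBlock≈ : ∀ T {m i} → Admissible T → i < m → ∀ X Y Z →
                  throughBlock T m i X Y Z ≈ r (m ∸ i) * X + s (m ∸ i) * Y + t0 R t (m ∸ i) * Z
  throughBlock≈ T {m} {i} adm i<m X Y Z = begin
    throughBlock T m i X Y Z
      ≈⟨ expand (weight T PQ m i) (weight T QP m i) (weight T QP' m i) (weight T PQ' m i)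
                (weight T QP m (suc i)) (weight T QP' m (suc i)) (weight T PP' m i) X Y Z ⟩
    upWeight T m i * X + levelWeight T m i * Y + downWeight T m i * Z
      ≈⟨ +-cong (+-cong (*-congʳ (upWeight≈r T adm (<⇒≤ i<m))) (*-congʳ (levelWeight≈s T adm (<⇒≤ i<m))))
                (*-congʳ (downWeight≈t T adm i<m)) ⟩
    r (m ∸ i) * X + s (m ∸ i) * Y + t0 R t (m ∸ i) * Z ∎
    where
    expand : ∀ w₁ w₂ w₃ w₄ w₅ w₆ w₇ X Y Z →
      w₁ * (w₂ * X + w₃ * Y) + w₄ * (w₅ * Y + w₆ * Z) + w₇ * Y
      ≈ w₁ * w₂ * X + (w₁ * w₃ + w₄ * w₅ + w₇) * Y + w₄ * w₆ * Z
    expand = solve 10 (λ w₁ w₂ w₃ w₄ w₅ w₆ w₇ X Y Z →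
      (w₁ :* (w₂ :* X :+ w₃ :* Y) :+ w₄ :* (w₅ :* Y :+ w₆ :* Z) :+ w₇ :* Y)
      := (w₁ :* w₂ :* X :+ (w₁ :* w₃ :+ w₄ :* w₅ :+ w₇) :* Y :+ w₄ :* w₆ :* Z)) refl

  throughTopBlock≈ : ∀ T {m} → Admissible T → ∀ X Y → throughTopBlock T m X Y ≈ r (m ∸ m) * X + s (m ∸ m) * Y
  throughTopBlock≈ T {m} adm X Y = begin
    throughTopBlock T m X Y
      ≈⟨ expand (weight T PQ m m) (weight T QP m m) (weight T QP' m m) (weight T PQ' m m)
                (weight T QP m (suc m)) (weight T PP' m m) X Y ⟩
    upWeight T m m * X + levelWeight T m m * Y
      ≈⟨ +-cong (*-congʳ (upWeight≈r T adm ≤-refl)) (*-congʳ (levelWeight≈s T adm ≤-refl)) ⟩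
    r (m ∸ m) * X + s (m ∸ m) * Y ∎
    where
    expand : ∀ w₁ w₂ w₃ w₄ w₅ w₇ X Y →
      w₁ * (w₂ * X + w₃ * Y) + w₄ * (w₅ * Y) + w₇ * Y ≈ w₁ * w₂ * X + (w₁ * w₃ + w₄ * w₅ + w₇) * Y
    expand = solve 8 (λ w₁ w₂ w₃ w₄ w₅ w₇ X Y →
      (w₁ :* (w₂ :* X :+ w₃ :* Y) :+ w₄ :* (w₅ :* Y) :+ w₇ :* Y)
      := (w₁ :* w₂ :* X :+ (w₁ :* w₃ :+ w₄ :* w₅ :+ w₇) :* Y)) refl

fuel-step : ∀ {L f} → 2 ℕ.* suc L ≤ f → ∃ λ f′ → f ≡ suc (suc f′) × 2 ℕ.* L ≤ f′
fuel-step {L} {f} 2+2L≤f rewrite *-suc 2 L with f | 2+2L≤f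
... | suc (suc f′) | s≤s (s≤s 2L≤f′) = f′ , ≡.refl , 2L≤f′

module GFToDiagonal {a ℓ} (R : CommutativeRing a ℓ) (r s t b c : ℕ → CommutativeRing.Carrier R)
                      (τ : ℕ → BlockType) (N B : ℕ) (B≤N : B ≤ N)
                      (admissible : ∀ m → m < N → BlockWeights.Admissible R r s t b c (τ m)) where
  open CommutativeRing R
  open GeneratingFunction R
  open DCProperties R r s t b c τ N
  open Ranked R D rank rank-increasing
  open Motzkin R r s t
  open BlockWeights R r s t b c using (throughBlock; throughTopBlock; throughBlock≈; throughTopBlock≈)
  open import Relation.Binary.Reasoning.Setoid setoid

  GF : ℕ → Vertex → Carrier
  GF f u = GFf R D f u (P B B)

  GF-P : ∀ f {i m} → i ≤ m → m < N → m ≢ B →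
         GF (suc f) (P i m) ≈ weight PQ m i * GF f (Q i m) + weight PQ' m i * GF f (Q (suc i) m)
                              + weight PP' m i * GF f (P (suc i) (suc m))
  GF-P f {i} {m} i≤m m<N m≢B = begin
    GF (suc f) (P i m)             ≈⟨ GFf-suc-≢ D f {P i m} (λ { ≡.refl → m≢B ≡.refl }) ⟩
    outSum D f (P B B) (D (P i m)) ≡⟨ ≡.cong (outSum D f (P B B)) (D-P i≤m m<N) ⟩
    _                              ≈⟨ trans (+-congˡ (+-congˡ (+-identityʳ _))) (sym (+-assoc _ _ _)) ⟩
    _                              ∎

  GF-Q : ∀ f {i m} → i ≤ m → m < N →
         GF (suc f) (Q i m) ≈ weight QP m i * GF f (P i (suc m)) + weight QP' m i * GF f (P (suc i) (suc m))
  GF-Q f {i} {m} i≤m m<N = begin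
    GF (suc f) (Q i m)             ≈⟨ GFf-suc-≢ D f {Q i m} (λ ()) ⟩
    outSum D f (P B B) (D (Q i m)) ≡⟨ ≡.cong (outSum D f (P B B)) (D-Q i≤m m<N) ⟩
    _                              ≈⟨ +-congˡ (+-identityʳ _) ⟩
    _                              ∎

  GF-Q-top : ∀ f {m} → m < N → GF (suc f) (Q (suc m) m) ≈ weight QP m (suc m) * GF f (P (suc m) (suc m))
  GF-Q-top f {m} m<N = begin
    GF (suc f) (Q (suc m) m)             ≈⟨ GFf-suc-≢ D f {Q (suc m) m} (λ ()) ⟩
    outSum D f (P B B) (D (Q (suc m) m)) ≡⟨ ≡.cong (outSum D f (P B B)) (D-Q-top m<N) ⟩
    _                                    ≈⟨ +-identityʳ _ ⟩
    _                                    ∎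

  GF≈motzkinAt : ℕ → ℕ → ℕ → Set ℓ
  GF≈motzkinAt L m f = ∀ {i} → i ≤ m → GF f (P i m) ≈ motzkin L (m ∸ i) 0

  GF≈motzkin-target : ∀ f → GF≈motzkinAt 0 B f
  GF≈motzkin-target f {i} i≤B = trans (GFf-sameRank f (P i B) (P B B) ≡.refl) (reflexive (δ≡kronecker (m≤n⇒m<n∨m≡n i≤B)))
    where
    δ≡kronecker : i < B ⊎ i ≡ B → δ (P i B) (P B B) ≡ kronecker (B ∸ i) 0
    δ≡kronecker (inj₁ i<B)
      rewrite ≢⇒==≡false {P i B} {P B B} (λ { ≡.refl → <-irrefl ≡.refl i<B }) | ∸≡suc∸suc i<B = ≡.refl
    δ≡kronecker (inj₂ ≡.refl) rewrite ==-refl (P B B) | n∸n≡0 B = ≡.refl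

  GF-Q≈ : ∀ {L i m f} → i ≤ m → m < N → GF≈motzkinAt L (suc m) f →
          GF (suc f) (Q i m) ≈ weight QP m i * motzkin L (suc m ∸ i) 0 + weight QP' m i * motzkin L (m ∸ i) 0
  GF-Q≈ {f = f} i≤m m<N next =
    trans (GF-Q f i≤m m<N) (+-cong (*-congˡ (next (m≤n⇒m≤1+n i≤m))) (*-congˡ (next (s≤s i≤m))))

  GF≈motzkin-step : ∀ {L m f} → m < N → m ≢ B →
                    GF≈motzkinAt L (suc m) f → GF≈motzkinAt L (suc m) (suc f) → GF≈motzkinAt (suc L) m (suc (suc f))
  GF≈motzkin-step {L} {m} {f} m<N m≢B next next′ {i} i≤m with m≤n⇒m<n∨m≡n i≤m
  ... | inj₁ i<m = begin
    GF (suc (suc f)) (P i m)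
      ≈⟨ GF-P (suc f) i≤m m<N m≢B ⟩
    weight PQ m i * GF (suc f) (Q i m) + weight PQ' m i * GF (suc f) (Q (suc i) m)
      + weight PP' m i * GF (suc f) (P (suc i) (suc m))
      ≈⟨ +-cong (+-cong (*-congˡ (GF-Q≈ {L} {f = f} i≤m m<N next)) (*-congˡ (GF-Q≈ {L} {f = f} i<m m<N next)))
                (*-congˡ (next′ (s≤s i≤m))) ⟩
    throughBlock (τ m) m i (motzkin L (suc m ∸ i) 0) (motzkin L (m ∸ i) 0) (motzkin L (m ∸ suc i) 0)
      ≡⟨ ≡.cong₂ (λ x z → throughBlock (τ m) m i (motzkin L x 0) (motzkin L (m ∸ i) 0) (motzkin L z 0))
                 (+-∸-assoc 1 i≤m) (≡.sym (pred[m∸n]≡m∸[1+n] m i)) ⟩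
    throughBlock (τ m) m i (motzkin L (suc (m ∸ i)) 0) (motzkin L (m ∸ i) 0) (motzkin L (pred (m ∸ i)) 0)
      ≈⟨ throughBlock≈ (τ m) (admissible m m<N) i<m _ _ _ ⟩
    motzkin (suc L) (m ∸ i) 0 ∎
  ... | inj₂ ≡.refl = begin
    GF (suc (suc f)) (P i i)
      ≈⟨ GF-P (suc f) i≤m m<N m≢B ⟩
    weight PQ i i * GF (suc f) (Q i i) + weight PQ' i i * GF (suc f) (Q (suc i) i)
      + weight PP' i i * GF (suc f) (P (suc i) (suc i))
      ≈⟨ +-cong (+-cong (*-congˡ (GF-Q≈ {L} {f = f} i≤m m<N next))
                        (*-congˡ (trans (GF-Q-top f m<N) (*-congˡ (next ≤-refl)))))
                (*-congˡ (next′ ≤-refl)) ⟩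
    throughTopBlock (τ i) i (motzkin L (suc i ∸ i) 0) (motzkin L (i ∸ i) 0)
      ≡⟨ ≡.cong (λ x → throughTopBlock (τ i) i (motzkin L x 0) (motzkin L (i ∸ i) 0)) (+-∸-assoc 1 (≤-refl {i})) ⟩
    throughTopBlock (τ i) i (motzkin L (suc (i ∸ i)) 0) (motzkin L (i ∸ i) 0)
      ≈⟨ throughTopBlock≈ (τ i) (admissible i m<N) _ _ ⟩
    r (i ∸ i) * motzkin L (suc (i ∸ i)) 0 + s (i ∸ i) * motzkin L (i ∸ i) 0
      ≈⟨ +-identityʳ _ ⟨
    r (i ∸ i) * motzkin L (suc (i ∸ i)) 0 + s (i ∸ i) * motzkin L (i ∸ i) 0 + 0#
      ≈⟨ +-congˡ noDownStep ⟨
    motzkin (suc L) (i ∸ i) 0 ∎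
    where
    noDownStep : t0 R t (i ∸ i) * motzkin L (pred (i ∸ i)) 0 ≈ 0#
    noDownStep rewrite n∸n≡0 i = zeroˡ _

  GF≈motzkin : ∀ L {m f} → m ℕ.+ L ≡ B → 2 ℕ.* L ≤ f → GF≈motzkinAt L m f
  GF≈motzkin zero {m} {f} m+0≡B _ rewrite ≡.trans (≡.sym (ℕₚ.+-identityʳ m)) m+0≡B = GF≈motzkin-target f
  GF≈motzkin (suc L) {m} m+1+L≡B 2+2L≤f with fuel-step 2+2L≤f
  ... | f′ , ≡.refl , 2L≤f′ =
    GF≈motzkin-step {L} {m} {f′} m<N (<⇒≢ m<B)
      (GF≈motzkin L 1+m+L≡B 2L≤f′) (GF≈motzkin L 1+m+L≡B (m≤n⇒m≤1+n 2L≤f′))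
    where
    1+m+L≡B : suc m ℕ.+ L ≡ B
    1+m+L≡B = ≡.trans (≡.sym (+-suc m L)) m+1+L≡B
    m<B : m < B
    m<B = ≤-trans (s≤s (m≤m+n m L)) (≤-reflexive 1+m+L≡B)
    m<N : m < N
    m<N = <-≤-trans m<B B≤N

module Indices (k n i j : ℕ) (i≤n : i ≤ n) (j≤n : j ≤ n) where
  N A B : ℕ
  N = 2 ℕ.* n ℕ.+ k
  A = n ℕ.+ k ∸ i
  B = n ℕ.+ k ℕ.+ j

  n+k+n≡N : n ℕ.+ k ℕ.+ n ≡ N
  n+k+n≡N = lemma n k
    where lemma : ∀ n k → n ℕ.+ k ℕ.+ n ≡ 2 ℕ.* n ℕ.+ k
          lemma = solve-∀

  A+[i+j]≡B : A ℕ.+ (i ℕ.+ j) ≡ B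
  A+[i+j]≡B = ≡.trans (≡.sym (ℕₚ.+-assoc A i j)) (≡.cong (ℕ._+ j) (m∸n+n≡m (≤-trans i≤n (m≤m+n n k))))

  B≤N : B ≤ N
  B≤N = ≤-trans (+-monoʳ-≤ (n ℕ.+ k) j≤n) (≤-reflexive n+k+n≡N)

  A≤N : A ≤ N
  A≤N = ≤-trans (m∸n≤m (n ℕ.+ k) i) (≤-trans (m≤m+n (n ℕ.+ k) j) B≤N)

  k≤A : k ≤ A
  k≤A = m+n≤o⇒m≤o∸n k (≤-trans (+-monoʳ-≤ k i≤n) (≤-reflexive (ℕₚ.+-comm k n)))

  2A≤1+2N : 2 ℕ.* A ≤ suc (2 ℕ.* N)
  2A≤1+2N = ≤-trans (*-monoʳ-≤ 2 A≤N) (n≤1+n _)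

  2[i+j]≤1+2N : 2 ℕ.* (i ℕ.+ j) ≤ suc (2 ℕ.* N)
  2[i+j]≤1+2N = ≤-trans (*-monoʳ-≤ 2 i+j≤N) (n≤1+n _)
    where
    i+j≤N : i ℕ.+ j ≤ N
    i+j≤N = ≤-trans (ℕₚ.+-mono-≤ i≤n j≤n) (≤-trans (ℕₚ.+-monoˡ-≤ n (m≤m+n n k)) (≤-reflexive n+k+n≡N))

corollary2p4 : ∀ {a ℓ} (R : CommutativeRing a ℓ)
                 (r s t b c : ℕ → CommutativeRing.Carrier R)
                 (τ : ℕ → BlockType) (k n : ℕ) →
                 (∀ m → m < 2 ℕ.* n ℕ.+ k → τ m ≡ type5 → Type5Admissible R r s t b c) →
                 ∀ i j → i ≤ n → j ≤ n →
                 CommutativeRing._≈_ R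
                   (catalan R r s t (i ℕ.+ j) 0)
                   (GF-H R r s t b c τ k n
                      (P (n ℕ.+ k ∸ i) (n ℕ.+ k ∸ i))
                      (P (n ℕ.+ k ℕ.+ j) (n ℕ.+ k ℕ.+ j)))
corollary2p4 R r s t b c τ k n admissible i j i≤n j≤n = begin
  catalan R r s t (i ℕ.+ j) 0            ≈⟨ catalan≈motzkin (i ℕ.+ j) 0 ⟩
  motzkin (i ℕ.+ j) 0 0                  ≡⟨ ≡.cong (λ h → motzkin (i ℕ.+ j) h 0) (n∸n≡0 A) ⟨
  motzkin (i ℕ.+ j) (A ∸ A) 0            ≈⟨ GF≈motzkin (i ℕ.+ j) {A} A+[i+j]≡B 2[i+j]≤1+2N ≤-refl ⟨
  GFf R D (fuel R N) (P A A) (P B B)     ≈⟨ GFf-subgraphOnPaths (fuel R N) P[k]⇝P[A] (diagonal⇝ B≤N ≤-refl) ⟨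
  GF-H R r s t b c τ k n (P A A) (P B B) ∎
  where
  open CommutativeRing R
  open import Relation.Binary.Reasoning.Setoid setoid
  open Indices k n i j i≤n j≤n
  open GeneratingFunction R using (_⊢_⇝[_]_)
  open DCProperties R r s t b c τ N
  open Motzkin R r s t using (motzkin; catalan≈motzkin)
  open GFToDiagonal R r s t b c τ N B B≤N admissible using (GF≈motzkin)
  open SubgraphOnPaths R D rank N rank-increasing rank-bounded (P k k) (P N N) (n≤1+n _) using (GFf-subgraphOnPaths)
  open Ranked R D rank rank-increasing using (⇝-within)

  P[k]⇝P[A] : D ⊢ P k k ⇝[ fuel R N ] P A A
  P[k]⇝P[A] = ⇝-within 2A≤1+2N (diagonal⇝ k≤A A≤N)
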